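{- Let $\gamma>1$, let $\mathcal{F}$ be a finite set of facilities, let $j$ be a client with distances $c_{ij}\ge 0$ ($i\in\mathcal{F}$), let $\overline{r}_j$ be a positive integer, and let $\overline{x}_{ij}\in[0,1]$ ($i\in\mathcal{F}$) satisfy $\sum_{i\in\mathcal{F}}\overline{x}_{ij}\ge\gamma\,\overline{r}_j$. With $\overline{x}^{(c)}_{ij}$, $\overline{x}^{(d)}_{ij}$, $d_j$, $d^{(c)}_j$, $d^{(d)}_j$ and $R_j$ defined as in the context, we have $$d^{(d)}_j\ \le\ d_j\Bigl(1+\frac{R_j}{\gamma-1}\Bigr).$$
   Context: Order the facilities as $i_1,i_2,\dots,i_{|\mathcal{F}|}$ so that $c_{i_1 j}\le c_{i_2 j}\le\cdots$. Let $k$ be the index with $\sum_{l=1}^{k-1}\overline{x}_{i_l j}<\overline{r}_j\le\sum_{l=1}^{k}\overline{x}_{i_l j}$. Define $\overline{x}^{(c)}_{i_l j}=\overline{x}_{i_l j}$ for $l<k$, $\overline{x}^{(c)}_{i_k j}=\overline{r}_j-\sum_{l=1}^{k-1}\overline{x}_{i_l j}$, $\overline{x}^{(c)}_{i_l j}=0$ for $l>k$, and $\overline{x}^{(d)}_{ij}=\overline{x}_{ij}-\overline{x}^{(c)}_{ij}$. Define the weighted averages $d_j=\frac{\sum_i c_{ij}\overline{x}_{ij}}{\sum_i\overline{x}_{ij}}$, $d^{(c)}_j=\frac{\sum_i c_{ij}\overline{x}^{(c)}_{ij}}{\sum_i\overline{x}^{(c)}_{ij}}$, $d^{(d)}_j=\frac{\sum_i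 c_{ij}\overline{x}^{(d)}_{ij}}{\sum_i\overline{x}^{(d)}_{ij}}$, and $R_j=\frac{d_j-d^{(c)}_j}{d_j}$ if $d_j>0$, $R_j=0$ otherwise.
   Formalization: The parameter γ, the distances $c_{ij}$ and the values $\overline{x}_{ij}$ are rational. -}

module Defs where

open import Data.Nat as ℕ using (ℕ; zero; suc)
open import Data.Fin using (Fin; zero; suc; toℕ)
open import Data.Fin.Permutation using (Permutation′; _⟨$⟩ʳ_; _⟨$⟩ˡ_)
open import Data.Rational using (ℚ; 0ℚ; 1ℚ; _+_; _-_; _*_; _÷_; ≢-nonZero)
open import Data.Rational.Properties using (_≟_)
open import Relation.Nullary using (yes; no)

Σ : {n : ℕ} → (Fin n → ℚ) → ℚ
Σ {zero}  f = 0ℚ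
Σ {suc n} f = f zero + Σ {n} (λ i → f (suc i))

-- Division a / b, with the convention a / 0 = 0 (only used where the
-- denominator is provably positive under the hypotheses of the lemma).
_/′_ : ℚ → ℚ → ℚ
a /′ b with b ≟ 0ℚ
... | yes _  = 0ℚ
... | no b≢0 = _÷_ a b {{≢-nonZero b≢0}}

-- Facilities are Fin n; σ lists them in order: position l ↦ facility σ l
-- (positions are 0-based, the paper's i_{l+1} is σ ⟨$⟩ʳ l).

prefix : {n : ℕ} → Permutation′ n → (Fin n → ℚ) → Fin n → ℚ
prefix σ x l = Σ (λ m → if< (toℕ m) (toℕ l) (x (σ ⟨$⟩ʳ m)))
  where
  if< : ℕ → ℕ → ℚ → ℚ
  if< a b q with a ℕ.<? b
  ... | yes _ = q
  ... | no  _ = 0ℚ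

xcPos : {n : ℕ} → Permutation′ n → (Fin n → ℚ) → ℚ → Fin n → Fin n → ℚ
xcPos σ x r k l with toℕ l ℕ.<? toℕ k | toℕ l ℕ.≟ toℕ k
... | yes _ | _     = x (σ ⟨$⟩ʳ l)
... | no _  | yes _ = r - prefix σ x k
... | no _  | no _  = 0ℚ

xc : {n : ℕ} → Permutation′ n → (Fin n → ℚ) → ℚ → Fin n → Fin n → ℚ
xc σ x r k i = xcPos σ x r k (σ ⟨$⟩ˡ i)

xd : {n : ℕ} → Permutation′ n → (Fin n → ℚ) → ℚ → Fin n → Fin n → ℚ
xd σ x r k i = x i - xc σ x r k i

wavg : {n : ℕ} → (Fin n → ℚ) → (Fin n → ℚ) → ℚ
wavg c y = Σ (λ i → c i * y i) /′ Σ y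

Rj : ℚ → ℚ → ℚ
Rj d dc with d Data.Rational.<? 0ℚ | d ≟ 0ℚ
... | _ | yes _ = 0ℚ
... | yes _ | no _ = 0ℚ
... | no _ | no _ = (d - dc) /′ d

-- Put t = c_{i_k j}, the cost at which the demand r̄_j is met.  Every facility in the
-- close part x̄^(c) costs at most t and every facility in the distant part x̄^(d) at
-- least t, so d^(c) ≤ t ≤ d^(d).  Writing A = Σ x̄^(c) = r̄_j and B = Σ x̄^(d), the
-- average d is the mixture (d^(c) A + d^(d) B) / (A + B), and A + B ≥ γ A gives
--   (A + B) (γ d − d^(c) − (γ − 1) d^(d)) = (d^(d) − d^(c)) (A + B − γ A) ≥ 0,
-- i.e. (γ − 1) d^(d) ≤ γ d − d^(c) = (γ − 1) d + d R_j.  When d ≤ 0, where R_j = 0,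
-- the same inequality and d^(c) ≥ 0 ≥ d give d^(d) ≤ d.
module Submission where

open import Defs
open import Algebra.Bundles using (CommutativeRing)
import Algebra.Properties.CommutativeMonoid.Sum as CommutativeMonoidSum
import Algebra.Properties.Semiring.Sum as SemiringSum
open import Data.Empty using (⊥-elim)
open import Data.Fin using (Fin; toℕ; zero; suc)
open import Data.Fin.Permutation as Perm using (Permutation′; _⟨$⟩ʳ_; _⟨$⟩ˡ_; inverseʳ)
open import Data.Fin.Properties using (toℕ-injective; suc-injective)
import Data.Integer as ℤ
open import Data.Nat as ℕ using (ℕ)
import Data.Nat.Properties as ℕₚ
open import Data.Product using (_×_; proj₁)
open import Data.Rational
  using (ℚ; 0ℚ; 1ℚ; _+_; _-_; _*_; _≤_; _<_; _/_; -_; 1/_; positive; nonNegative; ≢-nonZero)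
open import Data.Rational.Properties
open import Data.Rational.Solver using (module +-*-Solver)
open import Data.Sum using (_⊎_; inj₁; inj₂)
open import Function using (_∘_)
open import Relation.Binary.PropositionalEquality
open import Relation.Nullary using (yes; no)

open +-*-Solver
open CommutativeMonoidSum +-0-commutativeMonoid using (sum; ∑-distrib-+; sum-permute)
open SemiringSum (CommutativeRing.semiring +-*-commutativeRing) using (*-distribˡ-sum)

p≤q⇒0≤q-p : ∀ {p q} → p ≤ q → 0ℚ ≤ q - p
p≤q⇒0≤q-p {p} {q} p≤q = subst (_≤ q - p) (+-inverseʳ p) (+-monoˡ-≤ (- p) p≤q)

0≤q-p⇒p≤q : ∀ {p q} → 0ℚ ≤ q - p → p ≤ q
0≤q-p⇒p≤q {p} {q} 0≤q-p = subst₂ _≤_ (+-identityʳ p) p+[q-p]≡q (+-monoʳ-≤ p 0≤q-p)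
  where
  p+[q-p]≡q : p + (q - p) ≡ q
  p+[q-p]≡q = solve 2 (λ p q → p :+ (q :- p) := q) refl p q

0≤p∧0≤q⇒0≤p*q : ∀ {p q} → 0ℚ ≤ p → 0ℚ ≤ q → 0ℚ ≤ p * q
0≤p∧0≤q⇒0≤p*q {p} {q} 0≤p 0≤q =
  nonNegative⁻¹ (p * q) {{nonNeg*nonNeg⇒nonNeg p {{nonNegative 0≤p}} q {{nonNegative 0≤q}}}}

*-cancelʳ-≤-0< : ∀ {p q} r → 0ℚ < r → p * r ≤ q * r → p ≤ q
*-cancelʳ-≤-0< r 0<r = *-cancelʳ-≤-pos r {{positive 0<r}}

p<q⇒0<q-p : ∀ {p q} → p < q → 0ℚ < q - p
p<q⇒0<q-p {p} {q} p<q = subst (_< q - p) (+-inverseʳ p) (+-monoˡ-< (- p) p<q)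

0<⇒≢0 : ∀ {p} → 0ℚ < p → p ≢ 0ℚ
0<⇒≢0 0<p p≡0 = <⇒≢ 0<p (sym p≡0)

*-≤-at-0 : ∀ p q {u} → u ≡ 0ℚ → p * u ≤ q * u
*-≤-at-0 p q refl = ≤-reflexive (trans (*-zeroʳ p) (sym (*-zeroʳ q)))

p≤q+r⇒p-q≤r : ∀ {p q r} → p ≤ q + r → p - q ≤ r
p≤q+r⇒p-q≤r {p} {q} {r} p≤q+r = subst (p - q ≤_) q+r-q≡r (+-monoˡ-≤ (- q) p≤q+r)
  where
  q+r-q≡r : q + r - q ≡ r
  q+r-q≡r = solve 2 (λ q r → q :+ r :- q := r) refl q r

/′-*-cancel : ∀ p {q} → q ≢ 0ℚ → (p /′ q) * q ≡ p
/′-*-cancel p {q} q≢0 with q ≟ 0ℚ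
... | yes q≡0 = ⊥-elim (q≢0 q≡0)
... | no q≢0′ = begin
  p * 1/ q * q    ≡⟨ *-assoc p (1/ q) q ⟩
  p * (1/ q * q)  ≡⟨ cong (p *_) (*-inverseˡ q) ⟩
  p * 1ℚ          ≡⟨ *-identityʳ p ⟩
  p               ∎
  where
  open ≡-Reasoning
  instance _ = ≢-nonZero q≢0′

*[1+0/′]-identity : ∀ p q → p * (1ℚ + 0ℚ /′ q) ≡ p
*[1+0/′]-identity p q with q ≟ 0ℚ
... | yes _   = trans (cong (p *_) (+-identityʳ 1ℚ)) (*-identityʳ p)
... | no q≢0 = trans (cong (λ s → p * (1ℚ + s)) (*-zeroˡ (1/ q)))
                     (trans (cong (p *_) (+-identityʳ 1ℚ)) (*-identityʳ p))
  where instance _ = ≢-nonZero q≢0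

Σ≡sum : ∀ {n} (f : Fin n → ℚ) → Σ f ≡ sum f
Σ≡sum {ℕ.zero}  f = refl
Σ≡sum {ℕ.suc n} f = cong (f zero +_) (Σ≡sum {n} (f ∘ suc))

Σ-cong : ∀ {n} {f g : Fin n → ℚ} → (∀ i → f i ≡ g i) → Σ f ≡ Σ g
Σ-cong {ℕ.zero}  f≗g = refl
Σ-cong {ℕ.suc n} f≗g = cong₂ _+_ (f≗g zero) (Σ-cong {n} (f≗g ∘ suc))

Σ-distrib-+ : ∀ {n} (f g : Fin n → ℚ) → Σ (λ i → f i + g i) ≡ Σ f + Σ g
Σ-distrib-+ {n} f g = trans (Σ≡sum {n} _)
  (trans (∑-distrib-+ f g) (sym (cong₂ _+_ (Σ≡sum f) (Σ≡sum g))))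

*-distribˡ-Σ : ∀ {n} p (f : Fin n → ℚ) → p * Σ f ≡ Σ (λ i → p * f i)
*-distribˡ-Σ {n} p f = trans (cong (p *_) (Σ≡sum f))
  (trans (*-distribˡ-sum p f) (sym (Σ≡sum {n} _)))

Σ-permute : ∀ {n} (σ : Permutation′ n) (f : Fin n → ℚ) → Σ (f ∘ (σ ⟨$⟩ˡ_)) ≡ Σ f
Σ-permute {n} σ f = trans (Σ≡sum {n} _)
  (trans (sym (sum-permute f (Perm.flip σ))) (sym (Σ≡sum f)))

Σ-mono-≤ : ∀ {n} {f g : Fin n → ℚ} → (∀ i → f i ≤ g i) → Σ f ≤ Σ g
Σ-mono-≤ {ℕ.zero}  f≤g = ≤-refl
Σ-mono-≤ {ℕ.suc n} f≤g = +-mono-≤ (f≤g zero) (Σ-mono-≤ {n} (f≤g ∘ suc))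

Σ-nonNeg : ∀ {n} {f : Fin n → ℚ} → (∀ i → 0ℚ ≤ f i) → 0ℚ ≤ Σ f
Σ-nonNeg {ℕ.zero}  0≤f = ≤-refl
Σ-nonNeg {ℕ.suc n} {f} 0≤f =
  subst (_≤ Σ f) (+-identityʳ 0ℚ) (+-mono-≤ (0≤f zero) (Σ-nonNeg {n} (0≤f ∘ suc)))

Σ-split : ∀ {n} (f g : Fin n → ℚ) → Σ f ≡ Σ g + Σ (λ i → f i - g i)
Σ-split {n} f g = trans (Σ-cong {n} (λ i → solve 2 (λ a b → a := b :+ (a :- b)) refl (f i) (g i)))
  (Σ-distrib-+ g (λ i → f i - g i))

Σ-except : ∀ {n} {f g : Fin n → ℚ} (k : Fin n) →
           (∀ l → l ≢ k → f l ≡ g l) → Σ f ≡ Σ g + (f k - g k)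
Σ-except {ℕ.suc n} {f} {g} zero f≡g = begin
  f zero + Σ {n} (f ∘ suc)                 ≡⟨ cong (f zero +_) (Σ-cong {n} (λ l → f≡g (suc l) λ ())) ⟩
  f zero + Σ {n} (g ∘ suc)                 ≡⟨ solve 3 (λ a b s → a :+ s := b :+ s :+ (a :- b))
                                            refl (f zero) (g zero) (Σ {n} (g ∘ suc)) ⟩
  g zero + Σ {n} (g ∘ suc) + (f zero - g zero) ∎
  where open ≡-Reasoning
Σ-except {ℕ.suc n} {f} {g} (suc k) f≡g = begin
  f zero + Σ {n} (f ∘ suc)                        ≡⟨ cong₂ _+_ (f≡g zero λ ())
                                                   (Σ-except {n} k (λ l l≢k → f≡g (suc l) (l≢k ∘ suc-injective))) ⟩
  g zero + (Σ {n} (g ∘ suc) + (f (suc k) - g (suc k))) ≡⟨ sym (+-assoc (g zero) _ _) ⟩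
  g zero + Σ {n} (g ∘ suc) + (f (suc k) - g (suc k))   ∎
  where open ≡-Reasoning

-- v is the share of a mass w at cost c that lies on the close side of a cut at cost t.
record ThresholdSplit (t c w v : ℚ) : Set where
  field
    close-nonNeg : 0ℚ ≤ v
    close≤whole  : v ≤ w
    close⇒cheap  : c ≤ t ⊎ v ≡ 0ℚ
    distant⇒dear : t ≤ c ⊎ v ≡ w

  distant-nonNeg : 0ℚ ≤ w - v
  distant-nonNeg = p≤q⇒0≤q-p close≤whole

  close-cost : c * v ≤ t * v
  close-cost with close⇒cheap
  ... | inj₁ c≤t = *-monoʳ-≤-nonNeg v {{nonNegative close-nonNeg}} c≤t
  ... | inj₂ v≡0 = *-≤-at-0 c t v≡0

  distant-cost : t * (w - v) ≤ c * (w - v)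
  distant-cost with distant⇒dear
  ... | inj₁ t≤c = *-monoʳ-≤-nonNeg (w - v) {{nonNegative distant-nonNeg}} t≤c
  ... | inj₂ v≡w = *-≤-at-0 t c (trans (cong (λ u → w - u) v≡w) (+-inverseʳ w))

prefixTerm : ∀ {n} → Permutation′ n → (Fin n → ℚ) → Fin n → Fin n → ℚ
prefixTerm σ x k m with toℕ m ℕ.<? toℕ k
... | yes _ = x (σ ⟨$⟩ʳ m)
... | no _  = 0ℚ

-- The left-hand side is the summand of prefix, a local function of Defs that
-- cannot be named; it is solved from the use of this lemma in prefix-Σ.
prefix-summand : ∀ {n} (σ : Permutation′ n) x (k m : Fin n) → _ ≡ prefixTerm σ x k m

prefix-Σ : ∀ {n} (σ : Permutation′ n) x k → prefix σ x k ≡ Σ (prefixTerm σ x k)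
prefix-Σ {n} σ x k = Σ-cong {n} (prefix-summand σ x k)

prefix-summand σ x k m with toℕ m ℕ.<? toℕ k
... | yes _ = refl
... | no _  = refl

prefixTerm-self : ∀ {n} (σ : Permutation′ n) x k → prefixTerm σ x k k ≡ 0ℚ
prefixTerm-self σ x k with toℕ k ℕ.<? toℕ k
... | yes k<k = ⊥-elim (ℕₚ.<-irrefl refl k<k)
... | no _    = refl

xcPos-self : ∀ {n} (σ : Permutation′ n) x r k → xcPos σ x r k k ≡ r - prefix σ x k
xcPos-self σ x r k with toℕ k ℕ.<? toℕ k | toℕ k ℕ.≟ toℕ k
... | yes k<k | _       = ⊥-elim (ℕₚ.<-irrefl refl k<k)
... | no _    | yes _   = refl
... | no _    | no k≢k = ⊥-elim (k≢k refl)

xcPos-≢ : ∀ {n} (σ : Permutation′ n) x r k l → l ≢ k → xcPos σ x r k l ≡ prefixTerm σ x k l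
xcPos-≢ σ x r k l l≢k with toℕ l ℕ.<? toℕ k | toℕ l ℕ.≟ toℕ k
... | yes _ | _       = refl
... | no _  | yes l≡k = ⊥-elim (l≢k (toℕ-injective l≡k))
... | no _  | no _    = refl

Σ-xc : ∀ {n} (σ : Permutation′ n) x r k → Σ (xc σ x r k) ≡ r
Σ-xc {n} σ x r k = begin
  Σ (xc σ x r k)                                                ≡⟨ Σ-permute σ (xcPos σ x r k) ⟩
  Σ (xcPos σ x r k)                                             ≡⟨ Σ-except k (xcPos-≢ σ x r k) ⟩
  Σ (prefixTerm σ x k) + (xcPos σ x r k k - prefixTerm σ x k k) ≡⟨ cong₂ (λ p q → p + q)
                                                                    (sym (prefix-Σ σ x k))
                                                                    (cong₂ _-_ (xcPos-self σ x r k) (prefixTerm-self σ x k)) ⟩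
  prefix σ x k + (r - prefix σ x k - 0ℚ)                        ≡⟨ solve 2 (λ p r → p :+ (r :- p :- con 0ℚ) := r)
                                                                    refl (prefix σ x k) r ⟩
  r                                                             ∎
  where open ≡-Reasoning

module _ {n} (c x : Fin n → ℚ) (r : ℚ) (σ : Permutation′ n) (k : Fin n)
         (x-nonNeg : ∀ i → 0ℚ ≤ x i)
         (c-sorted : ∀ l m → toℕ l ℕ.≤ toℕ m → c (σ ⟨$⟩ʳ l) ≤ c (σ ⟨$⟩ʳ m))
         (prefix<r : prefix σ x k < r)
         (r≤prefix+x : r ≤ prefix σ x k + x (σ ⟨$⟩ʳ k))
  where

  xcPos-split : ∀ l → ThresholdSplit (c (σ ⟨$⟩ʳ k)) (c (σ ⟨$⟩ʳ l)) (x (σ ⟨$⟩ʳ l)) (xcPos σ x r k l)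
  xcPos-split l with toℕ l ℕ.<? toℕ k | toℕ l ℕ.≟ toℕ k
  ... | yes l<k | _ = record
    { close-nonNeg = x-nonNeg _ ; close≤whole = ≤-refl
    ; close⇒cheap = inj₁ (c-sorted l k (ℕₚ.<⇒≤ l<k)) ; distant⇒dear = inj₂ refl }
  ... | no _ | yes l≡k with toℕ-injective l≡k
  ...   | refl = record
    { close-nonNeg = p≤q⇒0≤q-p (<⇒≤ prefix<r) ; close≤whole = p≤q+r⇒p-q≤r r≤prefix+x
    ; close⇒cheap = inj₁ ≤-refl ; distant⇒dear = inj₁ ≤-refl }
  xcPos-split l | no l≮k | no _ = record
    { close-nonNeg = ≤-refl ; close≤whole = x-nonNeg _
    ; close⇒cheap = inj₂ refl ; distant⇒dear = inj₁ (c-sorted k l (ℕₚ.≮⇒≥ l≮k)) }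

  xc-split : ∀ i → ThresholdSplit (c (σ ⟨$⟩ʳ k)) (c i) (x i) (xc σ x r k i)
  xc-split i = subst (λ j → ThresholdSplit (c (σ ⟨$⟩ʳ k)) (c j) (x j) (xc σ x r k i))
                     (inverseʳ σ) (xcPos-split (σ ⟨$⟩ˡ i))

wavg-*-Σ : ∀ {n} (c y : Fin n → ℚ) → 0ℚ < Σ y → wavg c y * Σ y ≡ Σ (λ i → c i * y i)
wavg-*-Σ c y 0<Σy = /′-*-cancel _ (0<⇒≢0 0<Σy)

wavg-≤ : ∀ {n} {c y : Fin n → ℚ} {t} → (∀ i → c i * y i ≤ t * y i) → 0ℚ < Σ y → wavg c y ≤ t
wavg-≤ {n} {c} {y} {t} cy≤ty 0<Σy = *-cancelʳ-≤-0< (Σ y) 0<Σy (begin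
  wavg c y * Σ y        ≡⟨ wavg-*-Σ c y 0<Σy ⟩
  Σ (λ i → c i * y i)   ≤⟨ Σ-mono-≤ {n} cy≤ty ⟩
  Σ (λ i → t * y i)     ≡⟨ *-distribˡ-Σ t y ⟨
  t * Σ y               ∎)
  where open ≤-Reasoning

≤-wavg : ∀ {n} {c y : Fin n → ℚ} {t} → (∀ i → t * y i ≤ c i * y i) → 0ℚ < Σ y → t ≤ wavg c y
≤-wavg {n} {c} {y} {t} ty≤cy 0<Σy = *-cancelʳ-≤-0< (Σ y) 0<Σy (begin
  t * Σ y               ≡⟨ *-distribˡ-Σ t y ⟩
  Σ (λ i → t * y i)     ≤⟨ Σ-mono-≤ {n} ty≤cy ⟩
  Σ (λ i → c i * y i)   ≡⟨ wavg-*-Σ c y 0<Σy ⟨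
  wavg c y * Σ y        ∎)
  where open ≤-Reasoning

wavg-nonNeg : ∀ {n} {c y : Fin n → ℚ} → (∀ i → 0ℚ ≤ c i * y i) → 0ℚ < Σ y → 0ℚ ≤ wavg c y
wavg-nonNeg {n} {c} {y} 0≤cy 0<Σy = *-cancelʳ-≤-0< (Σ y) 0<Σy (begin
  0ℚ * Σ y              ≡⟨ *-zeroˡ (Σ y) ⟩
  0ℚ                    ≤⟨ Σ-nonNeg {n} 0≤cy ⟩
  Σ (λ i → c i * y i)   ≡⟨ wavg-*-Σ c y 0<Σy ⟨
  wavg c y * Σ y        ∎)
  where open ≤-Reasoning

wavg-mixture : ∀ {n} (c y u : Fin n → ℚ) → let v = λ i → y i - u i in
               0ℚ < Σ u → 0ℚ < Σ v →
               wavg c y * (Σ u + Σ v) ≡ wavg c u * Σ u + wavg c v * Σ v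
wavg-mixture {n} c y u 0<Σu 0<Σv = begin
  wavg c y * (Σ u + Σ v)                        ≡⟨ cong (wavg c y *_) Σy≡Σu+Σv ⟨
  wavg c y * Σ y                                ≡⟨ wavg-*-Σ c y 0<Σy ⟩
  Σ (λ i → c i * y i)                           ≡⟨ Σ-split (λ i → c i * y i) (λ i → c i * u i) ⟩
  Σ (λ i → c i * u i) + Σ (λ i → c i * y i - c i * u i)
                                                ≡⟨ cong (Σ (λ i → c i * u i) +_) (Σ-cong {n} λ i →
                                                     solve 3 (λ c y u → c :* y :- c :* u := c :* (y :- u))
                                                       refl (c i) (y i) (u i)) ⟩
  Σ (λ i → c i * u i) + Σ (λ i → c i * v i)     ≡⟨ cong₂ _+_ (wavg-*-Σ c u 0<Σu) (wavg-*-Σ c v 0<Σv) ⟨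
  wavg c u * Σ u + wavg c v * Σ v               ∎
  where
  open ≡-Reasoning
  v : Fin n → ℚ
  v i = y i - u i
  Σy≡Σu+Σv : Σ y ≡ Σ u + Σ v
  Σy≡Σu+Σv = Σ-split y u
  0<Σy : 0ℚ < Σ y
  0<Σy = subst (0ℚ <_) (sym Σy≡Σu+Σv) (+-mono-< 0<Σu 0<Σv)

mixture-bound : ∀ {γ a b d dc dd} → 0ℚ < a + b → dc ≤ dd → γ * a ≤ a + b →
                d * (a + b) ≡ dc * a + dd * b → (γ - 1ℚ) * dd ≤ γ * d - dc
mixture-bound {γ} {a} {b} {d} {dc} {dd} 0<a+b dc≤dd γa≤a+b mixture =
  *-cancelʳ-≤-0< (a + b) 0<a+b (0≤q-p⇒p≤q (subst (0ℚ ≤_) (sym gap)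
    (0≤p∧0≤q⇒0≤p*q (p≤q⇒0≤q-p dc≤dd) (p≤q⇒0≤q-p γa≤a+b))))
  where
  gap : (γ * d - dc) * (a + b) - (γ - 1ℚ) * dd * (a + b) ≡ (dd - dc) * (a + b - γ * a)
  gap = begin
    (γ * d - dc) * (a + b) - (γ - 1ℚ) * dd * (a + b)
      ≡⟨ solve 6 (λ γ a b d dc dd →
           (γ :* d :- dc) :* (a :+ b) :- (γ :- con 1ℚ) :* dd :* (a :+ b)
           := γ :* (d :* (a :+ b)) :- dc :* (a :+ b) :- (γ :- con 1ℚ) :* dd :* (a :+ b))
         refl γ a b d dc dd ⟩
    γ * (d * (a + b)) - dc * (a + b) - (γ - 1ℚ) * dd * (a + b)
      ≡⟨ cong (λ m → γ * m - dc * (a + b) - (γ - 1ℚ) * dd * (a + b)) mixture ⟩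
    γ * (dc * a + dd * b) - dc * (a + b) - (γ - 1ℚ) * dd * (a + b)
      ≡⟨ solve 5 (λ γ a b dc dd →
           γ :* (dc :* a :+ dd :* b) :- dc :* (a :+ b) :- (γ :- con 1ℚ) :* dd :* (a :+ b)
           := (dd :- dc) :* (a :+ b :- γ :* a))
         refl γ a b dc dd ⟩
    (dd - dc) * (a + b - γ * a)
      ∎
    where open ≡-Reasoning

Rj-bound-≤0 : ∀ {γ d dc dd} → 1ℚ < γ → d ≤ 0ℚ → 0ℚ ≤ dc → (γ - 1ℚ) * dd ≤ γ * d - dc → dd ≤ d
Rj-bound-≤0 {γ} {d} {dc} {dd} 1<γ d≤0 0≤dc bound = *-cancelʳ-≤-0< (γ - 1ℚ) (p<q⇒0<q-p 1<γ) (begin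
  dd * (γ - 1ℚ)  ≡⟨ *-comm dd (γ - 1ℚ) ⟩
  (γ - 1ℚ) * dd  ≤⟨ bound ⟩
  γ * d - dc     ≤⟨ +-monoʳ-≤ (γ * d) (neg-antimono-≤ (≤-trans d≤0 0≤dc)) ⟩
  γ * d - d      ≡⟨ solve 2 (λ γ d → γ :* d :- d := d :* (γ :- con 1ℚ)) refl γ d ⟩
  d * (γ - 1ℚ)   ∎)
  where open ≤-Reasoning

Rj-bound-≢0 : ∀ {γ d dc dd} → 1ℚ < γ → d ≢ 0ℚ → (γ - 1ℚ) * dd ≤ γ * d - dc →
              dd ≤ d * (1ℚ + ((d - dc) /′ d) /′ (γ - 1ℚ))
Rj-bound-≢0 {γ} {d} {dc} {dd} 1<γ d≢0 bound = *-cancelʳ-≤-0< (γ - 1ℚ) 0<γ-1 (begin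
  dd * (γ - 1ℚ)                  ≡⟨ *-comm dd (γ - 1ℚ) ⟩
  (γ - 1ℚ) * dd                  ≤⟨ bound ⟩
  γ * d - dc                     ≡⟨ solve 3 (λ γ d dc → γ :* d :- dc := d :* (γ :- con 1ℚ) :+ (d :- dc)) refl γ d dc ⟩
  d * (γ - 1ℚ) + (d - dc)        ≡⟨ cong (d * (γ - 1ℚ) +_) (/′-*-cancel (d - dc) d≢0) ⟨
  d * (γ - 1ℚ) + R * d           ≡⟨ cong (λ s → d * (γ - 1ℚ) + s * d) (/′-*-cancel R (0<⇒≢0 0<γ-1)) ⟨
  d * (γ - 1ℚ) + q * (γ - 1ℚ) * d ≡⟨ solve 3 (λ γ d q → d :* (γ :- con 1ℚ) :+ q :* (γ :- con 1ℚ) :* d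
                                                     := d :* (con 1ℚ :+ q) :* (γ :- con 1ℚ)) refl γ d q ⟩
  d * (1ℚ + q) * (γ - 1ℚ)        ∎)
  where
  open ≤-Reasoning
  0<γ-1 : 0ℚ < γ - 1ℚ
  0<γ-1 = p<q⇒0<q-p 1<γ
  R q : ℚ
  R = (d - dc) /′ d
  q = R /′ (γ - 1ℚ)

Rj-bound : ∀ {γ d dc dd} → 1ℚ < γ → 0ℚ ≤ dc → (γ - 1ℚ) * dd ≤ γ * d - dc →
           dd ≤ d * (1ℚ + (Rj d dc /′ (γ - 1ℚ)))
Rj-bound {γ} {d} {dc} {dd} 1<γ 0≤dc bound with d <? 0ℚ | d ≟ 0ℚ
... | _       | yes d≡0 = subst (dd ≤_) (sym (*[1+0/′]-identity d (γ - 1ℚ)))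
                                  (Rj-bound-≤0 1<γ (≤-reflexive d≡0) 0≤dc bound)
... | yes d<0 | no _    = subst (dd ≤_) (sym (*[1+0/′]-identity d (γ - 1ℚ)))
                                  (Rj-bound-≤0 1<γ (<⇒≤ d<0) 0≤dc bound)
... | no _    | no d≢0  = Rj-bound-≢0 1<γ d≢0 bound

γa≤a+b⇒0<b : ∀ {γ a b} → 1ℚ < γ → 0ℚ < a → γ * a ≤ a + b → 0ℚ < b
γa≤a+b⇒0<b {γ} {a} {b} 1<γ 0<a γa≤a+b = <-≤-trans 0<[γ-1]a [γ-1]a≤b
  where
  0<[γ-1]a : 0ℚ < (γ - 1ℚ) * a
  0<[γ-1]a = positive⁻¹ _ {{pos*pos⇒pos (γ - 1ℚ) {{positive (p<q⇒0<q-p 1<γ)}} a {{positive 0<a}}}}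
  [γ-1]a≤b : (γ - 1ℚ) * a ≤ b
  [γ-1]a≤b = 0≤q-p⇒p≤q (subst (0ℚ ≤_)
    (solve 3 (λ γ a b → a :+ b :- γ :* a := b :- (γ :- con 1ℚ) :* a) refl γ a b)
    (p≤q⇒0≤q-p γa≤a+b))

0<[+r]/1 : ∀ {r} → 1 ℕ.≤ r → 0ℚ < ℤ.+ r / 1
0<[+r]/1 {ℕ.suc r} _ = positive⁻¹ _ {{normalize-pos (ℕ.suc r) 1}}

lemma1 : (n : ℕ) (γ : ℚ) (c x : Fin n → ℚ) (r : ℕ)
    → 1ℚ < γ
    → (∀ i → 0ℚ ≤ c i)
    → 1 ℕ.≤ r
    → (∀ i → 0ℚ ≤ x i × x i ≤ 1ℚ)
    → γ * (ℤ.+ r / 1) ≤ Σ x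
    → (σ : Permutation′ n)
    → (∀ l m → toℕ l ℕ.≤ toℕ m → c (σ ⟨$⟩ʳ l) ≤ c (σ ⟨$⟩ʳ m))
    → (k : Fin n)
    → prefix σ x k < (ℤ.+ r / 1)
    → (ℤ.+ r / 1) ≤ prefix σ x k + x (σ ⟨$⟩ʳ k)
    → let rq = ℤ.+ r / 1
          d  = wavg c x
          dc = wavg c (xc σ x rq k)
          dd = wavg c (xd σ x rq k)
      in dd ≤ d * (1ℚ + (Rj d dc /′ (γ - 1ℚ)))
lemma1 n γ c x r 1<γ c-nonNeg 1≤r x-unit γr≤Σx σ c-sorted k prefix<r r≤prefix+x =
  Rj-bound {d = wavg c x} 1<γ 0≤dc
    (mixture-bound {γ} (+-mono-< 0<A 0<B) dc≤dd γA≤A+B (wavg-mixture c x close 0<A 0<B))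
  where
  open ThresholdSplit
  rq = ℤ.+ r / 1
  close distant : Fin n → ℚ
  close   = xc σ x rq k
  distant = xd σ x rq k
  split : ∀ i → ThresholdSplit (c (σ ⟨$⟩ʳ k)) (c i) (x i) (close i)
  split = xc-split c x rq σ k (proj₁ ∘ x-unit) c-sorted prefix<r r≤prefix+x
  A≡r : Σ close ≡ rq
  A≡r = Σ-xc σ x rq k
  γA≤A+B : γ * Σ close ≤ Σ close + Σ distant
  γA≤A+B = subst₂ (λ a s → γ * a ≤ s) (sym A≡r) (Σ-split x close) γr≤Σx
  0<A : 0ℚ < Σ close
  0<A = subst (0ℚ <_) (sym A≡r) (0<[+r]/1 1≤r)
  0<B : 0ℚ < Σ distant
  0<B = γa≤a+b⇒0<b 1<γ 0<A γA≤A+B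
  0≤dc : 0ℚ ≤ wavg c close
  0≤dc = wavg-nonNeg {c = c} (λ i → 0≤p∧0≤q⇒0≤p*q (c-nonNeg i) (close-nonNeg (split i))) 0<A
  dc≤dd : wavg c close ≤ wavg c distant
  dc≤dd = ≤-trans (wavg-≤ {c = c} (close-cost ∘ split) 0<A)
                  (≤-wavg {c = c} {t = c (σ ⟨$⟩ʳ k)} (distant-cost ∘ split) 0<B)
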